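{- Let $n\ge 2$. The term $x\equiv(\neg x)^{n-1}$ implicitly defines $x$ in Łukasiewicz logic Ł, i.e. $x\equiv(\neg x)^{n-1},\ x'\equiv(\neg x')^{n-1}\vdash_{\text{Ł}} x\equiv x'$ for distinct variables $x,x'$. -}

module Defs where

open import Data.Nat using (ℕ; zero; suc)
open import Data.List using (List)
open import Data.List.Membership.Propositional using (_∈_)

infixr 5 _⇒_
data Fm : Set where
  var : ℕ → Fm
  ~_  : Fm → Fm
  _⇒_ : Fm → Fm → Fm

_⊙_ : Fm → Fm → Fm
φ ⊙ ψ = ~ (φ ⇒ ~ ψ)

_⇔_ : Fm → Fm → Fm
φ ⇔ ψ = (φ ⇒ ψ) ⊙ (ψ ⇒ φ)

-- strong power: φ^1 = φ, φ^(k+1) = φ ⊙ φ^k ; φ^0 := φ → φ (a theorem, i.e. ⊤;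
-- never used by the main statement since there k = n-1 ≥ 1)
pow : Fm → ℕ → Fm
pow φ zero = φ ⇒ φ
pow φ (suc zero) = φ
pow φ (suc (suc k)) = φ ⊙ pow φ (suc k)

-- Hilbert-style calculus of Łukasiewicz (infinite-valued) logic:
-- axioms Ł1–Ł4 and modus ponens, derivability from a finite list of premises.
infix 3 _⊢_
data _⊢_ (Γ : List Fm) : Fm → Set where
  hyp : ∀ {φ} → φ ∈ Γ → Γ ⊢ φ
  ax1 : ∀ φ ψ → Γ ⊢ φ ⇒ (ψ ⇒ φ)
  ax2 : ∀ φ ψ χ → Γ ⊢ (φ ⇒ ψ) ⇒ ((ψ ⇒ χ) ⇒ (φ ⇒ χ))
  ax3 : ∀ φ ψ → Γ ⊢ ((φ ⇒ ψ) ⇒ ψ) ⇒ ((ψ ⇒ φ) ⇒ φ)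
  ax4 : ∀ φ ψ → Γ ⊢ (~ ψ ⇒ ~ φ) ⇒ (φ ⇒ ψ)
  mp  : ∀ {φ ψ} → Γ ⊢ φ → Γ ⊢ φ ⇒ ψ → Γ ⊢ ψ

-- Put m = n − 1 ≥ 1 and let a, b be the two variables, so that the premises give
-- a ⇒ (¬a)ᵐ and (¬b)ᵐ ⇒ b. Since b ⇒ a ≤ ¬a ⇒ ¬b and strong powers distribute over
-- implication, (b ⇒ a)ᵐ ≤ (¬a)ᵐ ⇒ (¬b)ᵐ ≤ a ⇒ b. Prelinearity makes (a ⇒ b) ∨ (b ⇒ a)
-- a theorem, and c ∨ d ⊢ c ∨ dᵐ (in an MV-chain one of the disjuncts is 1), so
-- (a ⇒ b) ∨ (b ⇒ a)ᵐ is derivable; both disjuncts give a ⇒ b. Symmetrically b ⇒ a.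
module Submission where

open import Defs
open import Data.Nat using (ℕ; zero; suc; _≤_; _∸_; s≤s; z≤n)
open import Data.List using (List; _∷_; [])
open import Data.List.Relation.Unary.Any using (here; there)
open import Relation.Binary.PropositionalEquality using (_≢_; refl)

infixr 6 _∨_
_∨_ : Fm → Fm → Fm
φ ∨ ψ = (φ ⇒ ψ) ⇒ ψ

module Derived {Γ : List Fm} where

  infixr 4 _⨾_
  _⨾_ : ∀ {φ ψ χ} → Γ ⊢ φ ⇒ ψ → Γ ⊢ ψ ⇒ χ → Γ ⊢ φ ⇒ χ
  _⨾_ {φ} {ψ} {χ} f g = mp g (mp f (ax2 φ ψ χ))

  weaken : ∀ {ψ} φ → Γ ⊢ ψ → Γ ⊢ φ ⇒ ψ
  weaken {ψ} φ h = mp h (ax1 ψ φ)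

  -- Ł3 is commutativity of ∨: if τ is derivable, so is φ ∨ τ by Ł1, hence τ ∨ φ.
  discharge : ∀ {τ} φ → Γ ⊢ τ → Γ ⊢ (τ ⇒ φ) ⇒ φ
  discharge {τ} φ h = mp (weaken (φ ⇒ τ) h) (ax3 φ τ)

  ⇒-refl : ∀ φ → Γ ⊢ φ ⇒ φ
  ⇒-refl φ = ax1 φ (φ ⇒ φ ⇒ φ) ⨾ discharge φ (ax1 φ φ)

  assertion : ∀ φ ψ → Γ ⊢ φ ⇒ (φ ⇒ ψ) ⇒ ψ
  assertion φ ψ = ax1 φ (ψ ⇒ φ) ⨾ ax3 ψ φ

  ⇒-antimonoˡ : ∀ {φ ψ} χ → Γ ⊢ φ ⇒ ψ → Γ ⊢ (ψ ⇒ χ) ⇒ (φ ⇒ χ)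
  ⇒-antimonoˡ {φ} {ψ} χ h = mp h (ax2 φ ψ χ)

  exchange : ∀ φ ψ χ → Γ ⊢ (φ ⇒ ψ ⇒ χ) ⇒ (ψ ⇒ φ ⇒ χ)
  exchange φ ψ χ = ax2 φ (ψ ⇒ χ) χ ⨾ ⇒-antimonoˡ (φ ⇒ χ) (assertion ψ χ)

  flip : ∀ {φ ψ χ} → Γ ⊢ φ ⇒ ψ ⇒ χ → Γ ⊢ ψ ⇒ φ ⇒ χ
  flip {φ} {ψ} {χ} h = mp h (exchange φ ψ χ)

  prefixing : ∀ φ ψ χ → Γ ⊢ (ψ ⇒ χ) ⇒ (φ ⇒ ψ) ⇒ (φ ⇒ χ)
  prefixing φ ψ χ = flip (ax2 φ ψ χ)

  ⇒-monoʳ : ∀ {ψ χ} φ → Γ ⊢ ψ ⇒ χ → Γ ⊢ (φ ⇒ ψ) ⇒ (φ ⇒ χ)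
  ⇒-monoʳ {ψ} {χ} φ h = mp h (prefixing φ ψ χ)

  ⇒-mono : ∀ {φ φ′ ψ ψ′} → Γ ⊢ φ′ ⇒ φ → Γ ⊢ ψ ⇒ ψ′ → Γ ⊢ (φ ⇒ ψ) ⇒ (φ′ ⇒ ψ′)
  ⇒-mono {φ} {ψ′ = ψ′} f g = ⇒-monoʳ φ g ⨾ ⇒-antimonoˡ ψ′ f

  -- ¬¬φ ⇒ ¬φ ⇒ ¬⊤ by Ł1, which Ł4 turns into ⊤ ⇒ φ (with ⊤ := φ ⇒ φ).
  ¬¬-elim : ∀ φ → Γ ⊢ ~ ~ φ ⇒ φ
  ¬¬-elim φ = ax1 (~ ~ φ) (~ ~ τ) ⨾ ax4 (~ φ) (~ τ) ⨾ ax4 τ φ ⨾ discharge φ (⇒-refl φ)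
    where τ = φ ⇒ φ

  ¬¬-intro : ∀ φ → Γ ⊢ φ ⇒ ~ ~ φ
  ¬¬-intro φ = mp (¬¬-elim (~ φ)) (ax4 φ (~ ~ φ))

  contrapose : ∀ {φ ψ} → Γ ⊢ φ ⇒ ψ → Γ ⊢ ~ ψ ⇒ ~ φ
  contrapose {φ} {ψ} h = mp (¬¬-elim φ ⨾ h ⨾ ¬¬-intro ψ) (ax4 (~ ψ) (~ φ))

  contraposition : ∀ φ ψ → Γ ⊢ (φ ⇒ ψ) ⇒ (~ ψ ⇒ ~ φ)
  contraposition φ ψ =
    ⇒-antimonoˡ ψ (¬¬-elim φ) ⨾ ⇒-monoʳ (~ ~ φ) (¬¬-intro ψ) ⨾ ax4 (~ ψ) (~ φ)

  contraposition-¬ : ∀ φ ψ → Γ ⊢ (φ ⇒ ~ ψ) ⇒ (ψ ⇒ ~ φ)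
  contraposition-¬ φ ψ = contraposition φ (~ ψ) ⨾ ⇒-antimonoˡ (~ φ) (¬¬-intro ψ)

  uncurry : ∀ {φ ψ χ} → Γ ⊢ φ ⇒ ψ ⇒ χ → Γ ⊢ φ ⊙ ψ ⇒ χ
  uncurry {φ} {ψ} {χ} h = contrapose (flip (h ⨾ contraposition ψ χ)) ⨾ ¬¬-elim χ

  curry : ∀ {φ ψ χ} → Γ ⊢ φ ⊙ ψ ⇒ χ → Γ ⊢ φ ⇒ ψ ⇒ χ
  curry {φ} {ψ} {χ} h = flip (contrapose h ⨾ ¬¬-elim (φ ⇒ ~ ψ)) ⨾ ax4 ψ χ

  pairing : ∀ φ ψ → Γ ⊢ φ ⇒ ψ ⇒ φ ⊙ ψ
  pairing φ ψ = curry (⇒-refl (φ ⊙ ψ))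

  ⊙-intro : ∀ {φ ψ} → Γ ⊢ φ → Γ ⊢ ψ → Γ ⊢ φ ⊙ ψ
  ⊙-intro {φ} {ψ} f g = mp g (mp f (pairing φ ψ))

  ⊙-elimˡ : ∀ {φ ψ} → Γ ⊢ φ ⊙ ψ → Γ ⊢ φ
  ⊙-elimˡ {φ} {ψ} h = mp h (uncurry (ax1 φ ψ))

  ⊙-elimʳ : ∀ {φ ψ} → Γ ⊢ φ ⊙ ψ → Γ ⊢ ψ
  ⊙-elimʳ {φ} {ψ} h = mp h (uncurry (flip (ax1 ψ φ)))

  ⊙-mono : ∀ {φ φ′ ψ ψ′} → Γ ⊢ φ ⇒ φ′ → Γ ⊢ ψ ⇒ ψ′ → Γ ⊢ φ ⊙ ψ ⇒ φ′ ⊙ ψ′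
  ⊙-mono {φ′ = φ′} {ψ′ = ψ′} f g = uncurry (f ⨾ pairing φ′ ψ′ ⨾ ⇒-antimonoˡ (φ′ ⊙ ψ′) g)

  ⊙-⇒-distrib : ∀ φ ψ φ′ ψ′ → Γ ⊢ (φ ⇒ ψ) ⊙ (φ′ ⇒ ψ′) ⇒ (φ ⊙ φ′ ⇒ ψ ⊙ ψ′)
  ⊙-⇒-distrib φ ψ φ′ ψ′ = uncurry (flip (uncurry from-φ) ⨾ exchange (φ ⊙ φ′) F′ (ψ ⊙ ψ′))
    where
      F  = φ ⇒ ψ
      F′ = φ′ ⇒ ψ′
      then-ψ′ : Γ ⊢ (ψ′ ⇒ ψ ⊙ ψ′) ⇒ φ′ ⇒ F′ ⇒ ψ ⊙ ψ′
      then-ψ′ = prefixing F′ ψ′ (ψ ⊙ ψ′) ⨾ ⇒-antimonoˡ (F′ ⇒ ψ ⊙ ψ′) (assertion φ′ ψ′)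
      from-φ : Γ ⊢ φ ⇒ φ′ ⇒ F ⇒ F′ ⇒ ψ ⊙ ψ′
      from-φ = assertion φ ψ ⨾ ⇒-monoʳ F (pairing ψ ψ′ ⨾ then-ψ′) ⨾ exchange F φ′ (F′ ⇒ ψ ⊙ ψ′)

  ∨-elim : ∀ {φ ψ χ} → Γ ⊢ φ ⇒ χ → Γ ⊢ ψ ⇒ χ → Γ ⊢ φ ∨ ψ ⇒ χ
  ∨-elim {φ} {ψ} {χ} f g =
    ax3 φ ψ ⨾ ⇒-antimonoˡ φ (⇒-antimonoˡ φ g) ⨾ ax3 χ φ ⨾ discharge χ f

  -- x ⊙ (x ⇒ y) is the lattice meet x ∧ y; both sides are ¬(¬x ∨ ¬y) up to
  -- contraposition, and ∨ is commutative by Ł3.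
  ∧-comm : ∀ x y → Γ ⊢ x ⊙ (x ⇒ y) ⇒ y ⊙ (y ⇒ x)
  ∧-comm x y = contrapose
    ( contraposition-¬ y (y ⇒ x) ⨾ ⇒-antimonoˡ (~ y) (ax4 y x) ⨾ ax3 (~ x) (~ y)
    ⨾ ⇒-antimonoˡ (~ x) (contraposition x y) ⨾ contraposition-¬ (x ⇒ y) x)

  prelinearity : ∀ a b → Γ ⊢ (a ⇒ b) ∨ (b ⇒ a)
  prelinearity a b = exchange (a ⇒ b) b a ⨾ flip (curry b∧[b⇒Z]⇒a)
    where
      Z = (a ⇒ b) ⇒ a
      Z⇒b⇒Z⇒a : Γ ⊢ (Z ⇒ b) ⇒ (Z ⇒ a)
      Z⇒b⇒Z⇒a = ⇒-antimonoˡ b (ax1 a (a ⇒ b)) ⨾ assertion (a ⇒ b) a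
      b∧[b⇒Z]⇒a : Γ ⊢ b ⊙ (b ⇒ Z) ⇒ a
      b∧[b⇒Z]⇒a = ∧-comm b Z ⨾ ⊙-mono (⇒-refl Z) Z⇒b⇒Z⇒a ⨾ uncurry (assertion Z a)

  ∨-⊙ : ∀ {c d e} → Γ ⊢ c ∨ d → Γ ⊢ c ∨ e → Γ ⊢ c ∨ d ⊙ e
  ∨-⊙ {c} {d} {e} c∨d c∨e = mp c∨d (∨-elim (assertion c (d ⊙ e)) (mp c∨e c∨e⇒d⇒goal))
    where
      c∨e⇒d⇒goal : Γ ⊢ c ∨ e ⇒ d ⇒ c ∨ d ⊙ e
      c∨e⇒d⇒goal = ∨-elim (assertion c (d ⊙ e) ⨾ ax1 (c ∨ d ⊙ e) d)
                          (flip (pairing d e) ⨾ ⇒-monoʳ d (ax1 (d ⊙ e) (c ⇒ d ⊙ e)))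

  pow-mono : ∀ {φ ψ} k → Γ ⊢ φ ⇒ ψ → Γ ⊢ pow φ k ⇒ pow ψ k
  pow-mono {φ} {ψ} zero h = weaken (φ ⇒ φ) (⇒-refl ψ)
  pow-mono (suc zero) h = h
  pow-mono (suc (suc k)) h = ⊙-mono h (pow-mono (suc k) h)

  pow-⇒-distrib : ∀ k φ ψ → Γ ⊢ pow (φ ⇒ ψ) (suc k) ⇒ pow φ (suc k) ⇒ pow ψ (suc k)
  pow-⇒-distrib zero φ ψ = ⇒-refl (φ ⇒ ψ)
  pow-⇒-distrib (suc k) φ ψ =
    ⊙-mono (⇒-refl (φ ⇒ ψ)) (pow-⇒-distrib k φ ψ) ⨾ ⊙-⇒-distrib φ ψ (pow φ (suc k)) (pow ψ (suc k))

  ∨-pow : ∀ {c d} k → Γ ⊢ c ∨ d → Γ ⊢ c ∨ pow d (suc k)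
  ∨-pow zero h = h
  ∨-pow (suc k) h = ∨-⊙ h (∨-pow k h)

  ⇒-from-fixpoint-bounds : ∀ k a b → Γ ⊢ a ⇒ pow (~ a) (suc k) → Γ ⊢ pow (~ b) (suc k) ⇒ b →
                           Γ ⊢ a ⇒ b
  ⇒-from-fixpoint-bounds k a b a≤ ≤b =
    mp (∨-pow k (prelinearity a b)) (∨-elim (⇒-refl (a ⇒ b)) [b⇒a]ᵐ⇒a⇒b)
    where
      [b⇒a]ᵐ⇒a⇒b : Γ ⊢ pow (b ⇒ a) (suc k) ⇒ a ⇒ b
      [b⇒a]ᵐ⇒a⇒b = pow-mono (suc k) (contraposition b a) ⨾ pow-⇒-distrib k (~ a) (~ b) ⨾ ⇒-mono a≤ ≤b

open Derived

-- The argument works for arbitrary formulas.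
mainTheorem8 : (n : ℕ) → 2 ≤ n → (x x′ : ℕ) → x ≢ x′ →
    (var x ⇔ pow (~ var x) (n ∸ 1)) ∷ (var x′ ⇔ pow (~ var x′) (n ∸ 1)) ∷ [] ⊢ var x ⇔ var x′
mainTheorem8 (suc (suc k)) (s≤s (s≤s z≤n)) x x′ _ =
  ⊙-intro (⇒-from-fixpoint-bounds k (var x) (var x′) (⊙-elimˡ x⇔) (⊙-elimʳ x′⇔))
          (⇒-from-fixpoint-bounds k (var x′) (var x) (⊙-elimˡ x′⇔) (⊙-elimʳ x⇔))
  where
    x⇔  = hyp (here refl)
    x′⇔ = hyp (there (here refl))
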